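{- For online matching on the line with predictions, the algorithm Follow-The-Prediction (described below) has total matching cost at most $\textsc{Off}+2\eta$, and hence competitive ratio $1+2\eta/\textsc{Off}$, against any offline algorithm $\textsc{Off}$, where $\eta$ is the prediction error with respect to $\textsc{Off}$ and $\textsc{Off}$ also denotes its cost.
   Context: Online matching on the line: servers $S=\{s_1,\dots,s_n\}\subset\mathbb{R}$; requests $r_1,\dots,r_n\in\mathbb{R}$ arrive online, each must be irrevocably matched to a previously unmatched server at cost equal to their distance; the objective is the total cost. The configuration after $i$ requests is the set of matched servers. For sets (or multisets) $X,Y$ of equal size, $\mathit{dist}(X,Y)$ is the cost of a minimum-cost perfect matching between them. In round $i$ the algorithm also receives a predicted configuration $P_i\subseteq S$, $|P_i|=i$. For an offline algorithm with configurations $\textsc{Off}_i$, the error is $\eta=\sum_{i=1}^n\mathit{dist}(P_i,\textsc{Off}_i)$. Follow-The-Prediction: let $S_i$ be its configuration after round $i$ ($S_0=P_0=\emptyset$). Let $\mu_i$ be a minimum-cost perfect matching between $S_i$ and $P_i$ in which every server of $S_i\cap P_i$ is matched to itself, extended to all of $S$ by $\mu_i(q)=q$ for $q\notin S_i\cup P_i$. When $r_{i+1}$ and $P_{i+1}$ arrive, compute an optimal matching between $P_{i+1}$ and the multiset $P_i\cup\{r_{i+1}\}$ that maps each element of $P_{i+1}\cap P_i$ to itself; it matches $r_{i+1}$ to some server $s\in P_{i+1}\setminus P_i$. The algorithm matches $r_{i+1}$ to the server $\mu_i(s)$ (which is unmatched).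
   Formalization: The server positions $s_1,\dots,s_n$ and the requests $r_1,\dots,r_n$ are rational numbers rather than real numbers. -}

module Defs where

open import Data.Nat as ℕ using (ℕ; zero; suc; _<ᵇ_)
open import Data.Bool using (Bool; true; false; if_then_else_; _∧_; not)
open import Data.Fin as F using (Fin; toℕ)
open import Data.Fin.Subset using (Subset; _∈_; _∉_)
open import Data.Vec using (lookup)
open import Data.Rational using (ℚ; 0ℚ; _+_; _-_; _≤_) renaming (∣_∣ to abs)
open import Data.Product using (Σ; ∃; ∃-syntax; _×_)
open import Relation.Binary.PropositionalEquality using (_≡_; _≢_)
open import Relation.Nullary using (¬_)
open import Relation.Nullary.Decidable using (⌊_⌋)

sumFin : ∀ {n} → (Fin n → ℚ) → ℚ
sumFin {zero}  f = 0ℚ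
sumFin {suc n} f = f F.zero + sumFin (λ j → f (F.suc j))

sumBelow : ∀ {n} → ℕ → (Fin n → ℚ) → ℚ
sumBelow i f = sumFin (λ j → if toℕ j <ᵇ i then f j else 0ℚ)

sum1to : ℕ → (ℕ → ℚ) → ℚ
sum1to zero    f = 0ℚ
sum1to (suc k) f = sum1to k f + f (suc k)

-- The line.  Servers are indexed by Fin n; server q sits at position x q.

dist : ∀ {n} → (Fin n → ℚ) → Fin n → Fin n → ℚ
dist x p q = abs (x p - x q)

-- q is among the servers f j with j < i (the configuration after i
-- requests of an algorithm that matches request j to server f j).
InPrefix : ∀ {n} → (Fin n → Fin n) → ℕ → Fin n → Set
InPrefix f i q = ∃[ j ] (toℕ j ℕ.< i × f j ≡ q)

-- m restricted to the configuration {f j | j < i} is an injective map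
-- into Y, i.e. (sizes being equal) a perfect matching between them.
IsPrefixMatching : ∀ {n} → (Fin n → Fin n) → ℕ → Subset n → (Fin n → Fin n) → Set
IsPrefixMatching f i Y m =
  (∀ j → toℕ j ℕ.< i → m (f j) ∈ Y) ×
  (∀ j k → toℕ j ℕ.< i → toℕ k ℕ.< i → m (f j) ≡ m (f k) → f j ≡ f k)

prefixMatchCost : ∀ {n} → (Fin n → ℚ) → (Fin n → Fin n) → ℕ → (Fin n → Fin n) → ℚ
prefixMatchCost x f i m = sumBelow i (λ j → dist x (f j) (m (f j)))

IsDist : ∀ {n} → (Fin n → ℚ) → (Fin n → Fin n) → ℕ → Subset n → ℚ → Set
IsDist x f i Y d =
  (∃[ m ] (IsPrefixMatching f i Y m × prefixMatchCost x f i m ≡ d)) ×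
  (∀ m → IsPrefixMatching f i Y m → d ≤ prefixMatchCost x f i m)

-- Follow-The-Prediction, round i+1 (request index j with toℕ j = i)

IsFixingMatching : ∀ {n} → (Fin n → Fin n) → ℕ → Subset n → (Fin n → Fin n) → Set
IsFixingMatching alg i P μ =
  IsPrefixMatching alg i P μ ×
  (∀ q → InPrefix alg i q → q ∈ P → μ q ≡ q)

IsMu : ∀ {n} → (Fin n → ℚ) → (Fin n → Fin n) → ℕ → Subset n → (Fin n → Fin n) → Set
IsMu x alg i P μ =
  IsFixingMatching alg i P μ ×
  (∀ q → ¬ InPrefix alg i q → q ∉ P → μ q ≡ q) ×
  (∀ μ′ → IsFixingMatching alg i P μ′ →
     prefixMatchCost x alg i μ ≤ prefixMatchCost x alg i μ′)

-- A matching between P′ = P_{i+1} and the multiset P ∪ {r} = P_i ∪ {r_{i+1}}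
-- fixing P′ ∩ P: s ∈ P′ is the server matched to r, and ν matches
-- P′ ∖ {s} injectively (hence bijectively) to P.
IsRMatching : ∀ {n} → Subset n → Subset n → Fin n → (Fin n → Fin n) → Set
IsRMatching P′ P s ν =
  s ∈ P′ × s ∉ P ×
  (∀ q → q ∈ P′ → q ≢ s → ν q ∈ P) ×
  (∀ q q′ → q ∈ P′ → q′ ∈ P′ → q ≢ s → q′ ≢ s → ν q ≡ ν q′ → q ≡ q′) ×
  (∀ q → q ∈ P′ → q ∈ P → ν q ≡ q)

rMatchCost : ∀ {n} → (Fin n → ℚ) → ℚ → Subset n → Fin n → (Fin n → Fin n) → ℚ
rMatchCost x r P′ s ν =
  abs (r - x s) +
  sumFin (λ q → if lookup P′ q ∧ not ⌊ q F.≟ s ⌋ then dist x q (ν q) else 0ℚ)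

IsOptRMatching : ∀ {n} → (Fin n → ℚ) → ℚ → Subset n → Subset n → Fin n → (Fin n → Fin n) → Set
IsOptRMatching x r P′ P s ν =
  IsRMatching P′ P s ν ×
  (∀ s′ ν′ → IsRMatching P′ P s′ ν′ → rMatchCost x r P′ s ν ≤ rMatchCost x r P′ s′ ν′)

-- alg (request j ↦ server) is a possible run of Follow-The-Prediction on
-- requests r and predictions P (any tie-breaking among optimal matchings).
IsFtPRun : ∀ {n} → (Fin n → ℚ) → (Fin n → ℚ) → (ℕ → Subset n) → (Fin n → Fin n) → Set
IsFtPRun {n} x r P alg =
  ∀ j → let i = toℕ j in
    Σ (Fin n → Fin n) λ μ → Σ (Fin n) λ s → Σ (Fin n → Fin n) λ ν →
      IsMu x alg i (P i) μ ×
      IsOptRMatching x (r j) (P (suc i)) (P i) s ν ×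
      alg j ≡ μ s

matchCost : ∀ {n} → (Fin n → ℚ) → (Fin n → ℚ) → (Fin n → Fin n) → ℚ
matchCost x r f = sumFin (λ j → abs (r j - x (f j)))

{-# OPTIONS --safe #-}
-- The proof is a potential-function argument. Let Φᵢ be the cost of μᵢ, the cheapest
-- matching between the configuration Sᵢ of the algorithm and the prediction Pᵢ that fixes
-- Sᵢ ∩ Pᵢ. In round i+1 the request r is served by a = μᵢ s, where s and ν form an optimal
-- matching of Pᵢ₊₁ with Pᵢ ∪ {r} fixing Pᵢ₊₁ ∩ Pᵢ. Matching Sᵢ₊₁ to Pᵢ₊₁ by μᵢ followed by
-- ν⁻¹, except that the server s stays at s, costs at most Φᵢ + cost ν − |s − a|, so
--   |r − a| + Φᵢ₊₁ ≤ |r − s| + |s − a| + Φᵢ₊₁ ≤ |r − s| + cost ν + Φᵢ.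
-- Composing the offline matchings of rounds i and i+1 bounds the optimal
-- |r − s| + cost ν by ηᵢ + |r − offᵢ₊₁| + ηᵢ₊₁. Both comparisons produce matchings that
-- need not fix the common points; by the triangle inequality any matching can be uncrossed
-- into one that does, at no extra cost. Telescoping over the rounds gives cost ≤ Off + 2η.

module Submission where

open import Defs
open import Data.Nat using (ℕ; _≤_)
open import Data.Fin using (Fin)
open import Data.Fin.Subset using (Subset; ∣_∣)
open import Data.Rational using (ℚ; _+_) renaming (_≤_ to _≤ℚ_)
open import Function.Definitions using (Injective)
open import Relation.Binary.PropositionalEquality using (_≡_)

import Data.Rational.Properties as QP
open import Algebra.Properties.AbelianGroup QP.+-0-abelianGroup using (⁻¹-anti-homo‿-)
open import Algebra.Solver.CommutativeMonoid QP.+-0-commutativeMonoid using (solve; _⊕_; _⊜_)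
open import Data.Bool using (Bool; true; false; T; not; _∧_; if_then_else_)
open import Data.Bool.Properties using (T?; T-≡; ∧-identityʳ)
open import Data.Empty using (⊥-elim)
open import Data.Fin using (zero; suc; toℕ; fromℕ<; _≟_)
import Data.Fin.Properties as FinP
open import Data.Fin.Subset using (_∈_; _∉_)
open import Data.List using (List; []; _∷_; allFin)
open import Data.List.Membership.Propositional using () renaming (_∈_ to _∈ˡ_)
open import Data.List.Membership.Propositional.Properties using (∈-allFin)
open import Data.List.Relation.Unary.Any using (here; there)
open import Data.Maybe using (Maybe; just; nothing; maybe′; fromMaybe)
import Data.Maybe.Properties as MaybeP
import Data.Nat as ℕ
open import Data.Nat using (zero; suc; _<_; _<ᵇ_; z≤n; s≤s)
import Data.Nat.Properties as ℕP
open import Data.Product using (Σ-syntax; ∃-syntax; _×_; _,_; proj₁; proj₂)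
open import Data.Rational using (0ℚ; _-_) renaming (∣_∣ to abs)
open import Data.Rational.Solver using (module +-*-Solver)
open import Data.Sum using (_⊎_; inj₁; inj₂)
open import Data.Unit using (⊤; tt)
open import Data.Vec using (lookup; []; _∷_)
import Data.Vec.Properties as VecP
open import Function using (_∘_; id)
open import Function.Bundles using (Equivalence)
open import Relation.Binary.Definitions using (DecidableEquality; tri<; tri≈; tri>)
open import Relation.Binary.PropositionalEquality using (refl; sym; trans; cong; cong₂; subst; subst₂; _≢_; module ≡-Reasoning)
open import Relation.Nullary using (¬_; ¬?; Dec; yes; no)
open import Relation.Nullary.Decidable using (⌊_⌋; _×-dec_)

private variable
  m n : ℕ

abs-sub-comm : ∀ p q → abs (p - q) ≡ abs (q - p)
abs-sub-comm p q = trans (sym (QP.∣-p∣≡∣p∣ (p - q))) (cong abs (⁻¹-anti-homo‿- p q))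

abs-sub-self : ∀ p → abs (p - p) ≡ 0ℚ
abs-sub-self p = cong abs (QP.+-inverseʳ p)

abs-sub-triangle : ∀ p q r → abs (p - r) ≤ℚ abs (p - q) + abs (q - r)
abs-sub-triangle p q r =
  subst (λ d → abs d ≤ℚ abs (p - q) + abs (q - r)) (sym (split p q r)) (QP.∣p+q∣≤∣p∣+∣q∣ (p - q) (q - r))
  where
  open +-*-Solver using (_:-_; _:+_; _:=_) renaming (solve to solve-ring)
  split : ∀ p q r → p - r ≡ (p - q) + (q - r)
  split = solve-ring 3 (λ p q r → p :- r := (p :- q) :+ (q :- r)) refl

p≤p+q : ∀ p {q} → 0ℚ ≤ℚ q → p ≤ℚ p + q
p≤p+q p {q} 0≤q = subst (_≤ℚ p + q) (QP.+-identityʳ p) (QP.+-monoʳ-≤ p 0≤q)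

if-T : ∀ {A : Set} {b} {u v : A} → T b → (if b then u else v) ≡ u
if-T {b = true} _ = refl

if-¬T : ∀ {A : Set} {b} {u v : A} → ¬ T b → (if b then u else v) ≡ v
if-¬T {b = true}  ¬b = ⊥-elim (¬b tt)
if-¬T {b = false} _  = refl

T-ext : ∀ {a b} → (T a → T b) → (T b → T a) → a ≡ b
T-ext {false} {false} _ _ = refl
T-ext {false} {true}  _ b⇒a = ⊥-elim (b⇒a tt)
T-ext {true}  {false} a⇒b _ = ⊥-elim (a⇒b tt)
T-ext {true}  {true}  _ _ = refl

_∖_ : (Fin n → Bool) → Fin n → Fin n → Bool
(D ∖ k) q = D q ∧ not ⌊ q ≟ k ⌋

T-∖⁺ : ∀ {D : Fin n → Bool} {k q} → T (D q) → q ≢ k → T ((D ∖ k) q)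
T-∖⁺ {D = D} {k} {q} d q≢k with D q | q ≟ k
... | true | no _ = tt
... | true | yes q≡k = q≢k q≡k

T-∖⁻ : ∀ {D : Fin n → Bool} {k q} → T ((D ∖ k) q) → T (D q) × q ≢ k
T-∖⁻ {D = D} {k} {q} d with D q | q ≟ k
... | true | no q≢k = tt , q≢k

∈⇒T : ∀ {P : Subset n} {q} → q ∈ P → T (lookup P q)
∈⇒T q∈P = subst T (sym (VecP.[]=⇒lookup q∈P)) tt

T⇒∈ : ∀ {P : Subset n} {q} → T (lookup P q) → q ∈ P
T⇒∈ {P = P} {q} t = VecP.lookup⇒[]= q P (Equivalence.to T-≡ t)

below : ℕ → Fin n → Bool
below i j = toℕ j <ᵇ i

T-below⁺ : ∀ {i} {k : Fin n} → toℕ k < i → T (below i k)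
T-below⁺ = ℕP.<⇒<ᵇ

T-below⁻ : ∀ {i} {k : Fin n} → T (below i k) → toℕ k < i
T-below⁻ {i = i} {k} = ℕP.<ᵇ⇒< (toℕ k) i

below-suc∖last : ∀ (j : Fin n) k → (below (suc (toℕ j)) ∖ j) k ≡ below (toℕ j) k
below-suc∖last j k = T-ext ⇒ ⇐
  where
  ⇒ : T ((below (suc (toℕ j)) ∖ j) k) → T (below (toℕ j) k)
  ⇒ t with T-∖⁻ {D = below (suc (toℕ j))} {j} {k} t
  ... | k≤j , k≢j = T-below⁺ {k = k} (ℕP.≤∧≢⇒< (ℕP.≤-pred (T-below⁻ {k = k} k≤j)) (k≢j ∘ FinP.toℕ-injective))
  ⇐ : T (below (toℕ j) k) → T ((below (suc (toℕ j)) ∖ j) k)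
  ⇐ t = T-∖⁺ {D = below (suc (toℕ j))} (T-below⁺ {k = k} (ℕP.m<n⇒m<1+n k<j)) (λ k≡j → ℕP.<-irrefl (cong toℕ k≡j) k<j)
    where
    k<j : toℕ k < toℕ j
    k<j = T-below⁻ {k = k} t

below-suc-view : ∀ {j k : Fin n} → T (below (suc (toℕ j)) k) → toℕ k < toℕ j ⊎ k ≡ j
below-suc-view {j = j} {k} t with ℕP.m<1+n⇒m<n∨m≡n (T-below⁻ {k = k} t)
... | inj₁ k<j = inj₁ k<j
... | inj₂ k≡j = inj₂ (FinP.toℕ-injective k≡j)

record MapsInjectively {Y : Set} (D : Fin m → Bool) (V : Y → Set) (g : Fin m → Y) : Set where
  field
    into      : ∀ {j} → T (D j) → V (g j)
    injective : ∀ {j k} → T (D j) → T (D k) → g j ≡ g k → j ≡ k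

open MapsInjectively

mapsInjectively-tail : ∀ {Y : Set} {D : Fin (suc m) → Bool} {V : Y → Set} {g} →
  MapsInjectively D V g → MapsInjectively (D ∘ suc) V (g ∘ suc)
mapsInjectively-tail ι = record
  { into = ι .into ; injective = λ d d′ eq → FinP.suc-injective (ι .injective d d′ eq) }

mapsInjectively-avoid : ∀ {D : Fin m → Bool} {B : Fin n → Bool} {g b} →
  (∀ {j} → T (D j) → g j ≢ b) → MapsInjectively D (T ∘ B) g → MapsInjectively D (T ∘ (B ∖ b)) g
mapsInjectively-avoid {B = B} avoids ι = record
  { into = λ d → T-∖⁺ {D = B} (ι .into d) (avoids d) ; injective = ι .injective }

mapsInjectively-avoid-head : ∀ {D : Fin (suc m) → Bool} {B : Fin n → Bool} {g} → T (D zero) →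
  MapsInjectively D (T ∘ B) g → MapsInjectively (D ∘ suc) (T ∘ (B ∖ g zero)) (g ∘ suc)
mapsInjectively-avoid-head d₀ ι =
  mapsInjectively-avoid (λ d → FinP.0≢1+n ∘ sym ∘ ι .injective d d₀) (mapsInjectively-tail ι)

mapsInjectively-∘ : ∀ {Y : Set} {D : Fin m → Bool} {E : Fin n → Bool} {V : Y → Set} {g h} →
  MapsInjectively D (T ∘ E) g → MapsInjectively E V h → MapsInjectively D V (h ∘ g)
mapsInjectively-∘ ι κ = record
  { into = κ .into ∘ ι .into
  ; injective = λ dj dk eq → ι .injective dj dk (κ .injective (ι .into dj) (ι .into dk) eq) }

sumFin-cong : ∀ {f g : Fin n → ℚ} → (∀ j → f j ≡ g j) → sumFin f ≡ sumFin g
sumFin-cong {zero}  eq = refl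
sumFin-cong {suc n} eq = cong₂ _+_ (eq zero) (sumFin-cong (eq ∘ suc))

sumFin-mono : ∀ {f g : Fin n → ℚ} → (∀ j → f j ≤ℚ g j) → sumFin f ≤ℚ sumFin g
sumFin-mono {zero}  le = QP.≤-refl
sumFin-mono {suc n} le = QP.+-mono-≤ (le zero) (sumFin-mono (le ∘ suc))

sumFin-distrib-+ : ∀ (f g : Fin n → ℚ) → sumFin (λ j → f j + g j) ≡ sumFin f + sumFin g
sumFin-distrib-+ {zero}  f g = sym (QP.+-identityˡ 0ℚ)
sumFin-distrib-+ {suc n} f g =
  trans (cong (f zero + g zero +_) (sumFin-distrib-+ (f ∘ suc) (g ∘ suc)))
        (interchange (f zero) (g zero) (sumFin (f ∘ suc)) (sumFin (g ∘ suc)))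
  where
  interchange : ∀ a b c d → (a + b) + (c + d) ≡ (a + c) + (b + d)
  interchange = solve 4 (λ a b c d → (a ⊕ b) ⊕ (c ⊕ d) ⊜ (a ⊕ c) ⊕ (b ⊕ d)) refl

sumFin-toℕ-snoc : ∀ (g : ℕ → ℚ) m → sumFin {suc m} (g ∘ toℕ) ≡ sumFin {m} (g ∘ toℕ) + g m
sumFin-toℕ-snoc g zero    = trans (QP.+-identityʳ (g 0)) (sym (QP.+-identityˡ (g 0)))
sumFin-toℕ-snoc g (suc m) = trans (cong (g 0 +_) (sumFin-toℕ-snoc (g ∘ suc) m))
                                  (sym (QP.+-assoc (g 0) (sumFin {m} (g ∘ suc ∘ toℕ)) (g (suc m))))

sumFin≡sum1to : ∀ (η : ℕ → ℚ) m → sumFin {m} (λ j → η (suc (toℕ j))) ≡ sum1to m η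
sumFin≡sum1to η zero    = refl
sumFin≡sum1to η (suc m) = trans (sumFin-toℕ-snoc (η ∘ suc) m) (cong (_+ η (suc m)) (sumFin≡sum1to η m))

telescope : ∀ (a b : Fin n → ℚ) (Φ : ℕ → ℚ) → (∀ j → a j + Φ (suc (toℕ j)) ≤ℚ b j + Φ (toℕ j)) →
  sumFin a + Φ n ≤ℚ sumFin b + Φ 0
telescope {zero}  a b Φ step = QP.≤-refl
telescope {suc n} a b Φ step = begin
  (a zero + sumFin (a ∘ suc)) + Φ (suc n)   ≡⟨ QP.+-assoc (a zero) _ _ ⟩
  a zero + (sumFin (a ∘ suc) + Φ (suc n))
    ≤⟨ QP.+-monoʳ-≤ (a zero) (telescope (a ∘ suc) (b ∘ suc) (Φ ∘ suc) (step ∘ suc)) ⟩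
  a zero + (sumFin (b ∘ suc) + Φ 1)         ≡⟨ swap-inner (a zero) (sumFin (b ∘ suc)) (Φ 1) ⟩
  (a zero + Φ 1) + sumFin (b ∘ suc)         ≤⟨ QP.+-monoˡ-≤ (sumFin (b ∘ suc)) (step zero) ⟩
  (b zero + Φ 0) + sumFin (b ∘ suc)         ≡⟨ swap-inner (b zero) (sumFin (b ∘ suc)) (Φ 0) ⟨
  b zero + (sumFin (b ∘ suc) + Φ 0)         ≡⟨ QP.+-assoc (b zero) _ _ ⟨
  (b zero + sumFin (b ∘ suc)) + Φ 0         ∎
  where
  open QP.≤-Reasoning
  swap-inner : ∀ u v w → u + (v + w) ≡ (u + w) + v
  swap-inner = solve 3 (λ u v w → u ⊕ (v ⊕ w) ⊜ (u ⊕ w) ⊕ v) refl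

-- prefixMatchCost x f i m is sumOn (below i) (λ j → dist x (f j) (m (f j))) and the second summand
-- of rMatchCost x ρ P′ s ν is sumOn (lookup P′ ∖ s) (λ q → dist x q (ν q)), both by definition.
sumOn : (Fin n → Bool) → (Fin n → ℚ) → ℚ
sumOn D f = sumFin (λ q → if D q then f q else 0ℚ)

sumOn-cong : ∀ (D : Fin n → Bool) {f g} → (∀ {q} → T (D q) → f q ≡ g q) → sumOn D f ≡ sumOn D g
sumOn-cong D eq = sumFin-cong λ q → pointwise (D q) eq
  where
  pointwise : ∀ b {u v} → (T b → u ≡ v) → (if b then u else 0ℚ) ≡ (if b then v else 0ℚ)
  pointwise true  eq = eq tt
  pointwise false eq = refl

sumOn-mono : ∀ (D : Fin n → Bool) {f g} → (∀ {q} → T (D q) → f q ≤ℚ g q) → sumOn D f ≤ℚ sumOn D g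
sumOn-mono D le = sumFin-mono λ q → pointwise (D q) le
  where
  pointwise : ∀ b {u v} → (T b → u ≤ℚ v) → (if b then u else 0ℚ) ≤ℚ (if b then v else 0ℚ)
  pointwise true  le = le tt
  pointwise false le = QP.≤-refl

sumOn-zero : ∀ (D : Fin n → Bool) → sumOn D (λ _ → 0ℚ) ≡ 0ℚ
sumOn-zero {zero}  D = refl
sumOn-zero {suc n} D = trans (cong (_+ sumOn (D ∘ suc) (λ _ → 0ℚ)) (if-idem (D zero)))
                             (trans (QP.+-identityˡ _) (sumOn-zero (D ∘ suc)))
  where
  if-idem : ∀ b → (if b then 0ℚ else 0ℚ) ≡ 0ℚ
  if-idem true  = refl
  if-idem false = refl

sumOn-nonneg : ∀ (D : Fin n → Bool) f → (∀ {q} → T (D q) → 0ℚ ≤ℚ f q) → 0ℚ ≤ℚ sumOn D f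
sumOn-nonneg D f nonneg = subst (_≤ℚ sumOn D f) (sumOn-zero D) (sumOn-mono D nonneg)

sumOn-distrib-+ : ∀ (D : Fin n → Bool) f g → sumOn D (λ q → f q + g q) ≡ sumOn D f + sumOn D g
sumOn-distrib-+ D f g =
  trans (sumFin-cong λ q → pointwise (D q))
        (sumFin-distrib-+ (λ q → if D q then f q else 0ℚ) (λ q → if D q then g q else 0ℚ))
  where
  pointwise : ∀ b {u v} → (if b then u + v else 0ℚ) ≡ (if b then u else 0ℚ) + (if b then v else 0ℚ)
  pointwise true  = refl
  pointwise false = sym (QP.+-identityˡ 0ℚ)

sumOn-cong-pred : ∀ {D E : Fin n → Bool} {f} → (∀ q → D q ≡ E q) → sumOn D f ≡ sumOn E f
sumOn-cong-pred eq = sumFin-cong λ q → cong (if_then _ else 0ℚ) (eq q)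

∖-suc : ∀ (D : Fin (suc n) → Bool) k q → (D ∖ suc k) (suc q) ≡ ((D ∘ suc) ∖ k) q
∖-suc D k q with q ≟ k
... | yes _ = refl
... | no  _ = refl

sumOn-split : ∀ {D : Fin n → Bool} {k} f → T (D k) → sumOn D f ≡ f k + sumOn (D ∖ k) f
sumOn-split {suc n} {D} {zero} f d with D zero
... | true = cong (f zero +_) (sym (trans (QP.+-identityˡ _) (sumOn-cong-pred λ q → ∧-identityʳ (D (suc q)))))
sumOn-split {suc n} {D} {suc k} f d = begin
  h₀ + sumOn (D ∘ suc) (f ∘ suc)                      ≡⟨ cong (h₀ +_) (sumOn-split (f ∘ suc) d) ⟩
  h₀ + (f (suc k) + sumOn ((D ∘ suc) ∖ k) (f ∘ suc))  ≡⟨ swap h₀ (f (suc k)) _ ⟩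
  f (suc k) + (h₀ + sumOn ((D ∘ suc) ∖ k) (f ∘ suc))
    ≡⟨ cong (f (suc k) +_) (cong₂ _+_ h₀≡ (sumOn-cong-pred (sym ∘ ∖-suc D k))) ⟩
  f (suc k) + sumOn (D ∖ suc k) f                     ∎
  where
  open ≡-Reasoning
  h₀ : ℚ
  h₀ = if D zero then f zero else 0ℚ
  h₀≡ : h₀ ≡ (if (D ∖ suc k) zero then f zero else 0ℚ)
  h₀≡ = cong (if_then f zero else 0ℚ) (sym (∧-identityʳ (D zero)))
  swap : ∀ a b c → a + (b + c) ≡ b + (a + c)
  swap = solve 3 (λ a b c → a ⊕ (b ⊕ c) ⊜ b ⊕ (a ⊕ c)) refl

sumOn-below-suc : ∀ (j : Fin n) f → sumOn (below (suc (toℕ j))) f ≡ f j + sumOn (below (toℕ j)) f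
sumOn-below-suc j f = trans (sumOn-split f (T-below⁺ {k = j} (ℕP.n<1+n (toℕ j)))) (cong (f j +_) (sumOn-cong-pred (below-suc∖last j)))

sumOn-below-zero : ∀ (f : Fin n → ℚ) → sumOn (below 0) f ≡ 0ℚ
sumOn-below-zero {n} f = trans (sumOn-cong (below {n} 0) {f} {λ _ → 0ℚ} (λ ())) (sumOn-zero (below {n} 0))

sumOn-mono-twoPoints : ∀ {D : Fin n → Bool} {j k} f g → T (D j) → T (D k) → j ≢ k →
  f j + f k ≤ℚ g j + g k → (∀ {q} → q ≢ j → q ≢ k → f q ≡ g q) → sumOn D f ≤ℚ sumOn D g
sumOn-mono-twoPoints {D = D} {j} {k} f g dj dk j≢k le same =
  subst₂ _≤ℚ_ (sym (expand f)) (sym (expand g))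
    (QP.+-mono-≤ le (QP.≤-reflexive (sumOn-cong ((D ∖ j) ∖ k) λ d →
      same (proj₂ (T-∖⁻ {D = D} (proj₁ (T-∖⁻ {D = D ∖ j} d)))) (proj₂ (T-∖⁻ {D = D ∖ j} d)))))
  where
  dk′ : T ((D ∖ j) k)
  dk′ = T-∖⁺ {D = D} dk (j≢k ∘ sym)
  expand : ∀ h → sumOn D h ≡ (h j + h k) + sumOn ((D ∖ j) ∖ k) h
  expand h = trans (sumOn-split h dj) (trans (cong (h j +_) (sumOn-split h dk′)) (sym (QP.+-assoc (h j) (h k) _)))

sumOn-reindex-≤ : ∀ {D : Fin m → Bool} {B : Fin n → Bool} {g} h → MapsInjectively D (T ∘ B) g →
  (∀ {q} → T (B q) → 0ℚ ≤ℚ h q) → sumOn D (h ∘ g) ≤ℚ sumOn B h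
sumOn-reindex-≤ {m = zero} {B = B} h ι nonneg = sumOn-nonneg B h nonneg
sumOn-reindex-≤ {m = suc m} {D = D} {B} {g} h ι nonneg with D zero in d₀
... | false = subst (_≤ℚ sumOn B h) (sym (QP.+-identityˡ _)) (sumOn-reindex-≤ h (mapsInjectively-tail ι) nonneg)
... | true  = subst (h (g zero) + sumOn (D ∘ suc) (h ∘ g ∘ suc) ≤ℚ_) (sym (sumOn-split h (ι .into d)))
    (QP.+-monoʳ-≤ (h (g zero))
      (sumOn-reindex-≤ h (mapsInjectively-avoid-head d ι) (nonneg ∘ proj₁ ∘ T-∖⁻ {D = B})))
  where
  d : T (D zero)
  d = subst T (sym d₀) tt

count : (Fin n → Bool) → ℕ
count {zero}  D = 0
count {suc n} D = if D zero then suc (count (D ∘ suc)) else count (D ∘ suc)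

count-cong : ∀ {D E : Fin n → Bool} → (∀ q → D q ≡ E q) → count D ≡ count E
count-cong {zero}  eq = refl
count-cong {suc n} eq = cong₂ (λ b c → if b then suc c else c) (eq zero) (count-cong (eq ∘ suc))

count-split : ∀ {D : Fin n → Bool} {k} → T (D k) → count D ≡ suc (count (D ∖ k))
count-split {suc n} {D} {zero} d with D zero
... | true = cong suc (count-cong λ q → sym (∧-identityʳ (D (suc q))))
count-split {suc n} {D} {suc k} d with D zero
... | true  = cong suc (trans (count-split {D = D ∘ suc} d) (cong suc (count-cong (sym ∘ ∖-suc D k))))
... | false = trans (count-split {D = D ∘ suc} d) (cong suc (count-cong (sym ∘ ∖-suc D k)))

∣p∣≡count : ∀ (P : Subset n) → ∣ P ∣ ≡ count (lookup P)
∣p∣≡count []          = refl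
∣p∣≡count (true ∷ P)  = cong suc (∣p∣≡count P)
∣p∣≡count (false ∷ P) = ∣p∣≡count P

count-below : ∀ {i} → i ≤ n → count (below {n} i) ≡ i
count-below {zero}  z≤n     = refl
count-below {suc n} z≤n     = count-below {n} z≤n
count-below {suc n} (s≤s i≤n) = cong suc (count-below i≤n)

mapsInjectively⇒count≤ : ∀ {D : Fin m → Bool} {B : Fin n → Bool} {g} → MapsInjectively D (T ∘ B) g → count D ≤ count B
mapsInjectively⇒count≤ {m = zero}  ι = z≤n
mapsInjectively⇒count≤ {m = suc m} {D = D} {B} ι with D zero in d₀
... | false = mapsInjectively⇒count≤ (mapsInjectively-tail ι)
... | true  = subst (suc _ ≤_) (sym (count-split {D = B} (ι .into d)))
                    (s≤s (mapsInjectively⇒count≤ (mapsInjectively-avoid-head d ι)))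
  where
  d : T (D zero)
  d = subst T (sym d₀) tt

mapsInjectively⇒surjective : ∀ {D : Fin m → Bool} {B : Fin n → Bool} {g} → MapsInjectively D (T ∘ B) g →
  count B ≤ count D → ∀ {b} → T (B b) → ∃[ j ] (T (D j) × g j ≡ b)
mapsInjectively⇒surjective {D = D} {B} {g} ι B≤D {b} bB with FinP.any? (λ j → T? (D j) ×-dec (g j ≟ b))
... | yes hit = hit
... | no ¬hit = ⊥-elim (ℕP.<-irrefl refl (ℕP.≤-trans (subst (_≤ count D) (count-split {D = B} bB) B≤D)
                                                     (mapsInjectively⇒count≤ ι∖b)))
  where
  ι∖b : MapsInjectively D (T ∘ (B ∖ b)) g
  ι∖b = mapsInjectively-avoid (λ d gj≡b → ¬hit (_ , d , gj≡b)) ι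

mapsInjectively⇒inverse : ∀ {D B : Fin n → Bool} {g} → MapsInjectively D (T ∘ B) g → count B ≤ count D →
  Σ[ g⁻¹ ∈ (Fin n → Fin n) ] (∀ {b} → T (B b) → T (D (g⁻¹ b)) × g (g⁻¹ b) ≡ b)
mapsInjectively⇒inverse {n} {D} {B} {g} ι B≤D = g⁻¹ , g∘g⁻¹
  where
  g⁻¹ : Fin n → Fin n
  g⁻¹ b with T? (B b)
  ... | yes bB = proj₁ (mapsInjectively⇒surjective ι B≤D bB)
  ... | no  _  = b
  g∘g⁻¹ : ∀ {b} → T (B b) → T (D (g⁻¹ b)) × g (g⁻¹ b) ≡ b
  g∘g⁻¹ {b} bB with T? (B b)
  ... | yes bB′ = proj₂ (mapsInjectively⇒surjective ι B≤D bB′)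
  ... | no ¬bB  = ⊥-elim (¬bB bB)

injective⇒leftInverse : ∀ {f : Fin n → Fin n} → Injective _≡_ _≡_ f →
  Σ[ f⁻¹ ∈ (Fin n → Fin n) ] (∀ k → f⁻¹ (f k) ≡ k)
injective⇒leftInverse {n} {f} f-injective = f⁻¹ , f⁻¹∘f
  where
  f⁻¹ : Fin n → Fin n
  f⁻¹ q with FinP.any? (λ k → f k ≟ q)
  ... | yes (k , _) = k
  ... | no _        = q
  f⁻¹∘f : ∀ k → f⁻¹ (f k) ≡ k
  f⁻¹∘f k with FinP.any? (λ l → f l ≟ f k)
  ... | yes (l , fl≡fk) = f-injective fl≡fk
  ... | no none         = ⊥-elim (none (k , refl))

-- Uncrossing

-- An assignment τ sends each source j ∈ D, sitting at server φ j, to a target in V; a server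
-- q ∈ F has a copy embed q in V, and uncrossing makes every source at such a server keep its copy.
module Uncrossing {Y : Set} (_≟Y_ : DecidableEquality Y) (pos : Y → ℚ)
  (x : Fin n → ℚ) (embed : Fin n → Y) (pos-embed : ∀ q → pos (embed q) ≡ x q)
  (embed-injective : Injective _≡_ _≡_ embed)
  (D : Fin m → Bool) (φ : Fin m → Fin n) (φ-injective : ∀ {j k} → T (D j) → T (D k) → φ j ≡ φ k → j ≡ k)
  (F : Fin n → Bool) (V : Y → Set) (V-embed : ∀ {q} → T (F q) → V (embed q)) where

  gap : (Fin m → Y) → Fin m → ℚ
  gap τ k = abs (x (φ k) - pos (τ k))

  cost : (Fin m → Y) → ℚ
  cost τ = sumOn D (gap τ)

  Fixes : (Fin m → Y) → Fin m → Set
  Fixes τ k = T (D k) → T (F (φ k)) → τ k ≡ embed (φ k)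

  embed-gap : ∀ q → abs (x q - pos (embed q)) ≡ 0ℚ
  embed-gap q = trans (cong (λ p → abs (x q - p)) (pos-embed q)) (abs-sub-self (x q))

  -- If the point a of j₀ is fixable, j₀ takes a and the index c that held a (if any) takes j₀'s old
  -- target; by the triangle inequality through a the two changed gaps do not grow.
  module Swap {τ} (ι : MapsInjectively D V τ) {j₀} (d₀ : T (D j₀)) (f₀ : T (F (φ j₀))) where

    a : Fin n
    a = φ j₀

    occupant : Σ[ c ∈ Fin m ] T (D c) × (c ≢ j₀ → τ c ≡ embed a) ×
                             (∀ {k} → T (D k) → k ≢ j₀ → τ k ≡ embed a → k ≡ c)
    occupant with FinP.any? (λ k → T? (D k) ×-dec ¬? (k ≟ j₀) ×-dec (τ k ≟Y embed a))
    ... | yes (c , dc , _ , τc) = c , dc , (λ _ → τc) , (λ dk _ τk → ι .injective dk dc (trans τk (sym τc)))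
    ... | no none = j₀ , d₀ , (λ j₀≢j₀ → ⊥-elim (j₀≢j₀ refl))
                            , (λ dk k≢j₀ τk → ⊥-elim (none (_ , dk , k≢j₀ , τk)))

    c : Fin m
    c = proj₁ occupant

    dc : T (D c)
    dc = proj₁ (proj₂ occupant)

    τc : c ≢ j₀ → τ c ≡ embed a
    τc = proj₁ (proj₂ (proj₂ occupant))

    only-c : ∀ {k} → T (D k) → k ≢ j₀ → τ k ≡ embed a → k ≡ c
    only-c = proj₂ (proj₂ (proj₂ occupant))

    swapped : ∀ {k} → Dec (k ≡ j₀) → Dec (k ≡ c) → Y
    swapped (yes _) _       = embed a
    swapped (no _)  (yes _) = τ j₀
    swapped {k} (no _) (no _) = τ k

    τ′ : Fin m → Y
    τ′ k = swapped (k ≟ j₀) (k ≟ c)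

    data Position (k : Fin m) : Y → Set where
      at-j₀     : k ≡ j₀ → Position k (embed a)
      at-c      : k ≢ j₀ → k ≡ c → Position k (τ j₀)
      elsewhere : k ≢ j₀ → k ≢ c → Position k (τ k)

    position : ∀ k → Position k (τ′ k)
    position k = view (k ≟ j₀) (k ≟ c)
      where
      view : (k≟j₀ : Dec (k ≡ j₀)) (k≟c : Dec (k ≡ c)) → Position k (swapped k≟j₀ k≟c)
      view (yes k≡j₀) _          = at-j₀ k≡j₀
      view (no k≢j₀)  (yes k≡c) = at-c k≢j₀ k≡c
      view (no k≢j₀)  (no k≢c)  = elsewhere k≢j₀ k≢c

    τ′-j₀ : τ′ j₀ ≡ embed a
    τ′-j₀ with τ′ j₀ | position j₀
    ... | _ | at-j₀ _            = refl
    ... | _ | at-c j₀≢j₀ _       = ⊥-elim (j₀≢j₀ refl)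
    ... | _ | elsewhere j₀≢j₀ _  = ⊥-elim (j₀≢j₀ refl)

    τ′-c : c ≢ j₀ → τ′ c ≡ τ j₀
    τ′-c c≢j₀ with τ′ c | position c
    ... | _ | at-j₀ c≡j₀       = ⊥-elim (c≢j₀ c≡j₀)
    ... | _ | at-c _ _         = refl
    ... | _ | elsewhere _ c≢c  = ⊥-elim (c≢c refl)

    τ′-elsewhere : ∀ {k} → k ≢ j₀ → k ≢ c → τ′ k ≡ τ k
    τ′-elsewhere {k} k≢j₀ k≢c with τ′ k | position k
    ... | _ | at-j₀ k≡j₀      = ⊥-elim (k≢j₀ k≡j₀)
    ... | _ | at-c _ k≡c      = ⊥-elim (k≢c k≡c)
    ... | _ | elsewhere _ _   = refl

    τ′-maps : MapsInjectively D V τ′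
    τ′-maps = record { into = into′ ; injective = injective′ }
      where
      into′ : ∀ {k} → T (D k) → V (τ′ k)
      into′ {k} dk with τ′ k | position k
      ... | _ | at-j₀ _       = V-embed f₀
      ... | _ | at-c _ _      = ι .into d₀
      ... | _ | elsewhere _ _ = ι .into dk
      c≡j₀ : embed a ≡ τ j₀ → c ≡ j₀
      c≡j₀ eq with c ≟ j₀
      ... | yes c≡j₀ = c≡j₀
      ... | no c≢j₀  = ι .injective dc d₀ (trans (τc c≢j₀) eq)
      injective′ : ∀ {k l} → T (D k) → T (D l) → τ′ k ≡ τ′ l → k ≡ l
      injective′ {k} {l} dk dl eq with τ′ k | position k | τ′ l | position l
      ... | _ | at-j₀ k≡j₀ | _ | at-j₀ l≡j₀         = trans k≡j₀ (sym l≡j₀)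
      ... | _ | at-j₀ _    | _ | at-c l≢j₀ l≡c      = ⊥-elim (l≢j₀ (trans l≡c (c≡j₀ eq)))
      ... | _ | at-j₀ _    | _ | elsewhere l≢j₀ l≢c = ⊥-elim (l≢c (only-c dl l≢j₀ (sym eq)))
      ... | _ | at-c k≢j₀ k≡c | _ | at-j₀ _         = ⊥-elim (k≢j₀ (trans k≡c (c≡j₀ (sym eq))))
      ... | _ | at-c _ k≡c | _ | at-c _ l≡c         = trans k≡c (sym l≡c)
      ... | _ | at-c _ _   | _ | elsewhere l≢j₀ _   = ⊥-elim (l≢j₀ (sym (ι .injective d₀ dl eq)))
      ... | _ | elsewhere k≢j₀ k≢c | _ | at-j₀ _    = ⊥-elim (k≢c (only-c dk k≢j₀ eq))
      ... | _ | elsewhere k≢j₀ _ | _ | at-c _ _     = ⊥-elim (k≢j₀ (ι .injective dk d₀ eq))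
      ... | _ | elsewhere _ _ | _ | elsewhere _ _   = ι .injective dk dl eq

    fixes-j₀ : Fixes τ′ j₀
    fixes-j₀ _ _ = τ′-j₀

    fixes-preserved : ∀ {k} → Fixes τ k → Fixes τ′ k
    fixes-preserved {k} fix dk fk with τ′ k | position k
    ... | _ | at-j₀ refl       = refl
    ... | _ | at-c k≢j₀ refl   = ⊥-elim (k≢j₀ (φ-injective dk d₀ (embed-injective (trans (sym (fix dk fk)) (τc k≢j₀)))))
    ... | _ | elsewhere _ _    = fix dk fk

    cost-τ′ : cost τ′ ≤ℚ cost τ
    cost-τ′ with c ≟ j₀
    ... | yes c≡j₀ = sumOn-mono D pointwise
      where
      pointwise : ∀ {k} → T (D k) → gap τ′ k ≤ℚ gap τ k
      pointwise {k} _ with τ′ k | position k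
      ... | _ | at-j₀ refl       = subst (_≤ℚ gap τ j₀) (sym (embed-gap a)) (QP.0≤∣p∣ _)
      ... | _ | at-c k≢j₀ k≡c    = ⊥-elim (k≢j₀ (trans k≡c c≡j₀))
      ... | _ | elsewhere _ _    = QP.≤-refl
    ... | no c≢j₀ = sumOn-mono-twoPoints (gap τ′) (gap τ) d₀ dc (c≢j₀ ∘ sym) two-points
                      (λ k≢j₀ k≢c → cong (λ y → abs (x (φ _) - pos y)) (τ′-elsewhere k≢j₀ k≢c))
      where
      open QP.≤-Reasoning
      two-points : gap τ′ j₀ + gap τ′ c ≤ℚ gap τ j₀ + gap τ c
      two-points = begin
        gap τ′ j₀ + gap τ′ c
          ≡⟨ cong₂ _+_ (trans (cong (λ y → abs (x a - pos y)) τ′-j₀) (embed-gap a))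
                       (cong (λ y → abs (x (φ c) - pos y)) (τ′-c c≢j₀)) ⟩
        0ℚ + abs (x (φ c) - pos (τ j₀))                  ≡⟨ QP.+-identityˡ _ ⟩
        abs (x (φ c) - pos (τ j₀))                       ≤⟨ abs-sub-triangle (x (φ c)) (x a) (pos (τ j₀)) ⟩
        abs (x (φ c) - x a) + abs (x a - pos (τ j₀))     ≡⟨ QP.+-comm (abs (x (φ c) - x a)) (gap τ j₀) ⟩
        gap τ j₀ + abs (x (φ c) - x a)                   ≡⟨ cong (λ p → gap τ j₀ + abs (x (φ c) - p)) (sym pos-τc) ⟩
        gap τ j₀ + gap τ c                               ∎
        where
        pos-τc : pos (τ c) ≡ x a
        pos-τc = trans (cong pos (τc c≢j₀)) (pos-embed a)

  fix-one : ∀ {τ} j₀ → MapsInjectively D V τ →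
    Σ[ τ′ ∈ (Fin m → Y) ] MapsInjectively D V τ′ × Fixes τ′ j₀ × (∀ {k} → Fixes τ k → Fixes τ′ k) ×
                          cost τ′ ≤ℚ cost τ
  fix-one {τ} j₀ ι with T? (D j₀) ×-dec T? (F (φ j₀))
  ... | yes (d₀ , f₀) = τ′ , τ′-maps , fixes-j₀ , fixes-preserved , cost-τ′
    where open Swap ι d₀ f₀
  ... | no ¬fixable = τ , ι , (λ d₀ f₀ → ⊥-elim (¬fixable (d₀ , f₀))) , id , QP.≤-refl

  fix-all : ∀ {τ} (ks : List (Fin m)) → MapsInjectively D V τ →
    Σ[ τ′ ∈ (Fin m → Y) ] MapsInjectively D V τ′ × (∀ {k} → k ∈ˡ ks → Fixes τ′ k) × cost τ′ ≤ℚ cost τ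
  fix-all []       ι = _ , ι , (λ ()) , QP.≤-refl
  fix-all (k ∷ ks) ι with fix-all ks ι
  ... | τ₁ , ι₁ , fixes-ks , le₁ with fix-one k ι₁
  ... | τ₂ , ι₂ , fixes-k , preserved , le₂ = τ₂ , ι₂ , fixes , QP.≤-trans le₂ le₁
    where
    fixes : ∀ {l} → l ∈ˡ k ∷ ks → Fixes τ₂ l
    fixes (here refl)  = fixes-k
    fixes (there l∈ks) = preserved (fixes-ks l∈ks)

  uncross : ∀ {τ} → MapsInjectively D V τ →
    Σ[ τ′ ∈ (Fin m → Y) ] MapsInjectively D V τ′ × (∀ k → Fixes τ′ k) × cost τ′ ≤ℚ cost τ
  uncross ι with fix-all (allFin m) ι
  ... | τ′ , ι′ , fixes , le = τ′ , ι′ , (λ k → fixes (∈-allFin k)) , le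

-- Follow-The-Prediction

inPrefix? : ∀ (f : Fin n → Fin n) i q → Dec (InPrefix f i q)
inPrefix? f i q = FinP.any? (λ k → toℕ k ℕ.<? i ×-dec f k ≟ q)

module MinimalFixingMatching {x : Fin n → ℚ} {alg : Fin n → Fin n} {i} {P : Subset n} {μ}
                             (isMu : IsMu x alg i P μ) where

  μ-into : ∀ {k} → toℕ k < i → μ (alg k) ∈ P
  μ-into = proj₁ (proj₁ (proj₁ isMu)) _

  μ-injective : ∀ {k l} → toℕ k < i → toℕ l < i → μ (alg k) ≡ μ (alg l) → alg k ≡ alg l
  μ-injective = proj₂ (proj₁ (proj₁ isMu)) _ _

  μ-fixes : ∀ {q} → InPrefix alg i q → q ∈ P → μ q ≡ q
  μ-fixes = proj₂ (proj₁ isMu) _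

  μ-outside : ∀ {q} → ¬ InPrefix alg i q → q ∉ P → μ q ≡ q
  μ-outside = proj₁ (proj₂ isMu) _

  μ-minimal : ∀ μ′ → IsFixingMatching alg i P μ′ → prefixMatchCost x alg i μ ≤ℚ prefixMatchCost x alg i μ′
  μ-minimal = proj₂ (proj₂ isMu)

  moved⇒inPrefix : ∀ {s} → s ∉ P → μ s ≢ s → InPrefix alg i s
  moved⇒inPrefix {s} s∉P μs≢s with inPrefix? alg i s
  ... | yes s∈S = s∈S
  ... | no  s∉S = ⊥-elim (μs≢s (μ-outside s∉S s∉P))

  μ-fresh : ∀ {s} → s ∉ P → ¬ InPrefix alg i (μ s)
  μ-fresh {s} s∉P (k′ , k′<i , alg-k′≡μs) with inPrefix? alg i s
  ... | no s∉S = s∉S (k′ , k′<i , trans alg-k′≡μs (μ-outside s∉S s∉P))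
  ... | yes (k , k<i , alg-k≡s) = s∉P (subst (_∈ P) μs≡s μs∈P)
    where
    open ≡-Reasoning
    μs∈P : μ s ∈ P
    μs∈P = subst (λ q → μ q ∈ P) alg-k≡s (μ-into k<i)
    alg-k′≡alg-k : alg k′ ≡ alg k
    alg-k′≡alg-k = μ-injective k′<i k<i (begin
      μ (alg k′)  ≡⟨ μ-fixes (k′ , k′<i , refl) (subst (_∈ P) (sym alg-k′≡μs) μs∈P) ⟩
      alg k′      ≡⟨ alg-k′≡μs ⟩
      μ s         ≡⟨ cong μ alg-k≡s ⟨
      μ (alg k)   ∎)
    μs≡s : μ s ≡ s
    μs≡s = trans (sym alg-k′≡μs) (trans alg-k′≡alg-k alg-k≡s)

requestAssignment⇒fixingMatching : ∀ {x : Fin n → ℚ} {alg : Fin n → Fin n} {i} {P : Subset n} {τ} →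
  Injective _≡_ _≡_ alg → MapsInjectively (below i) (T ∘ lookup P) τ →
  (∀ k → T (below i k) → T (lookup P (alg k)) → τ k ≡ alg k) →
  Σ[ μ ∈ (Fin n → Fin n) ] IsFixingMatching alg i P μ ×
                            prefixMatchCost x alg i μ ≡ sumOn (below i) (λ k → dist x (alg k) (τ k))
requestAssignment⇒fixingMatching {n} {x} {alg} {i} {P} {τ} alg-injective τ-maps τ-fixes =
  μ , ((into′ , injective′) , fixes) , sumOn-cong (below i) (λ {k} _ → cong (dist x (alg k)) (μ∘alg k))
  where
  alg⁻¹ : Fin n → Fin n
  alg⁻¹ = proj₁ (injective⇒leftInverse alg-injective)
  μ : Fin n → Fin n
  μ = τ ∘ alg⁻¹
  μ∘alg : ∀ k → μ (alg k) ≡ τ k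
  μ∘alg k = cong τ (proj₂ (injective⇒leftInverse alg-injective) k)
  into′ : ∀ k → toℕ k < i → μ (alg k) ∈ P
  into′ k k<i = T⇒∈ (subst (T ∘ lookup P) (sym (μ∘alg k)) (τ-maps .into (T-below⁺ {k = k} k<i)))
  injective′ : ∀ k l → toℕ k < i → toℕ l < i → μ (alg k) ≡ μ (alg l) → alg k ≡ alg l
  injective′ k l k<i l<i eq = cong alg (τ-maps .injective (T-below⁺ {k = k} k<i) (T-below⁺ {k = l} l<i)
                                                           (trans (sym (μ∘alg k)) (trans eq (μ∘alg l))))
  fixes : ∀ q → InPrefix alg i q → q ∈ P → μ q ≡ q
  fixes _ (k , k<i , refl) q∈P = trans (μ∘alg k) (τ-fixes k (T-below⁺ {k = k} k<i) (∈⇒T q∈P))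

module PotentialDrop {x : Fin n → ℚ} {alg : Fin n → Fin n} (alg-injective : Injective _≡_ _≡_ alg)
  (j : Fin n) {P P′ : Subset n} (∣P∣≡ : ∣ P ∣ ≡ toℕ j) (∣P′∣≡ : ∣ P′ ∣ ≡ suc (toℕ j))
  {μ} (isMu : IsMu x alg (toℕ j) P μ) {s ν} (isR : IsRMatching P′ P s ν) (alg-j : alg j ≡ μ s) where

  open MinimalFixingMatching {x = x} isMu

  i : ℕ
  i = toℕ j

  a : Fin n
  a = alg j

  R : Fin n → Bool
  R = below (suc i)

  s∈P′ : s ∈ P′
  s∈P′ = proj₁ isR

  s∉P : s ∉ P
  s∉P = proj₁ (proj₂ isR)

  ν-maps : MapsInjectively (lookup P′ ∖ s) (T ∘ lookup P) ν
  ν-maps = record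
    { into      = λ {q} d → let q∈P′ , q≢s = T-∖⁻ {D = lookup P′} {s} {q} d in
                            ∈⇒T (proj₁ (proj₂ (proj₂ isR)) q (T⇒∈ q∈P′) q≢s)
    ; injective = λ {q} {q′} d d′ → let q∈P′ , q≢s = T-∖⁻ {D = lookup P′} {s} {q} d
                                        q′∈P′ , q′≢s = T-∖⁻ {D = lookup P′} {s} {q′} d′ in
                            proj₁ (proj₂ (proj₂ (proj₂ isR))) q q′ (T⇒∈ q∈P′) (T⇒∈ q′∈P′) q≢s q′≢s }

  ν-cost : ℚ
  ν-cost = sumOn (lookup P′ ∖ s) (λ q → dist x q (ν q))

  ν-inverse : Σ[ ν⁻¹ ∈ (Fin n → Fin n) ] (∀ {p} → T (lookup P p) → T ((lookup P′ ∖ s) (ν⁻¹ p)) × ν (ν⁻¹ p) ≡ p)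
  ν-inverse = mapsInjectively⇒inverse ν-maps (ℕP.≤-reflexive (begin
    count (lookup P)              ≡⟨ sym (∣p∣≡count P) ⟩
    ∣ P ∣                         ≡⟨ ∣P∣≡ ⟩
    i                             ≡⟨ ℕP.suc-injective (begin
      suc i                         ≡⟨ ∣P′∣≡ ⟨
      ∣ P′ ∣                        ≡⟨ ∣p∣≡count P′ ⟩
      count (lookup P′)             ≡⟨ count-split {D = lookup P′} (∈⇒T s∈P′) ⟩
      suc (count (lookup P′ ∖ s))   ∎) ⟩
    count (lookup P′ ∖ s)         ∎))
    where open ≡-Reasoning

  ν⁻¹ : Fin n → Fin n
  ν⁻¹ = proj₁ ν-inverse

  ν⁻¹-into : ∀ {p} → T (lookup P p) → T ((lookup P′ ∖ s) (ν⁻¹ p))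
  ν⁻¹-into = proj₁ ∘ proj₂ ν-inverse

  ν∘ν⁻¹ : ∀ {p} → T (lookup P p) → ν (ν⁻¹ p) ≡ p
  ν∘ν⁻¹ = proj₂ ∘ proj₂ ν-inverse

  -- If μ moves s then s ∈ Sᵢ; otherwise a = μ s = s is the new server.
  s-requested : ∃[ k₀ ] T (R k₀) × alg k₀ ≡ s
  s-requested with μ s ≟ s
  ... | yes μs≡s = j , T-below⁺ {k = j} (ℕP.n<1+n i) , trans alg-j μs≡s
  ... | no  μs≢s with moved⇒inPrefix s∉P μs≢s
  ...   | k , k<i , alg-k≡s = k , T-below⁺ {k = k} (ℕP.m<n⇒m<1+n k<i) , alg-k≡s

  k₀ : Fin n
  k₀ = proj₁ s-requested

  k₀∈R : T (R k₀)
  k₀∈R = proj₁ (proj₂ s-requested)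

  alg-k₀ : alg k₀ ≡ s
  alg-k₀ = proj₂ (proj₂ s-requested)

  k₀-old : k₀ ≢ j → toℕ k₀ < i
  k₀-old k₀≢j with below-suc-view {j = j} k₀∈R
  ... | inj₁ k₀<i = k₀<i
  ... | inj₂ k₀≡j = ⊥-elim (k₀≢j k₀≡j)

  -- The new server a = μ s already lies in Pᵢ (unless a = s), so it is its own partner.
  partner : Fin n → Fin n
  partner k = if below i k then μ (alg k) else alg k

  partner-old : ∀ {k} → toℕ k < i → partner k ≡ μ (alg k)
  partner-old {k} k<i = if-T (T-below⁺ {k = k} k<i)

  partner-new : partner j ≡ a
  partner-new = if-¬T (ℕP.<-irrefl refl ∘ T-below⁻ {k = j})

  partner-k₀ : partner k₀ ≡ a
  partner-k₀ with below-suc-view {j = j} k₀∈R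
  ... | inj₁ k₀<i = trans (partner-old k₀<i) (trans (cong μ alg-k₀) (sym alg-j))
  ... | inj₂ k₀≡j = trans (cong partner k₀≡j) partner-new

  partner-maps : MapsInjectively (R ∖ k₀) (T ∘ lookup P) partner
  partner-maps = record { into = into′ ; injective = injective′ }
    where
    view : ∀ {k} → T ((R ∖ k₀) k) → (toℕ k < i × k ≢ k₀) ⊎ (k ≡ j × k₀ ≢ j)
    view {k} d with T-∖⁻ {D = R} {k₀} {k} d
    ... | k∈R , k≢k₀ with below-suc-view {j = j} k∈R
    ...   | inj₁ k<i  = inj₁ (k<i , k≢k₀)
    ...   | inj₂ refl = inj₂ (refl , k≢k₀ ∘ sym)
    μs∈P : k₀ ≢ j → μ s ∈ P
    μs∈P k₀≢j = subst (λ q → μ q ∈ P) alg-k₀ (μ-into (k₀-old k₀≢j))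
    into′ : ∀ {k} → T ((R ∖ k₀) k) → T (lookup P (partner k))
    into′ d with view d
    ... | inj₁ (k<i , _)   = subst (T ∘ lookup P) (sym (partner-old k<i)) (∈⇒T (μ-into k<i))
    ... | inj₂ (refl , k₀≢j) = subst (T ∘ lookup P) (sym (trans partner-new alg-j)) (∈⇒T (μs∈P k₀≢j))
    old≢new : ∀ {k} → toℕ k < i → k ≢ k₀ → k₀ ≢ j → partner k ≢ partner j
    old≢new {k} k<i k≢k₀ k₀≢j eq = k≢k₀ (alg-injective (μ-injective k<i (k₀-old k₀≢j) (begin
      μ (alg k)   ≡⟨ partner-old k<i ⟨
      partner k   ≡⟨ eq ⟩
      partner j   ≡⟨ partner-new ⟩
      alg j       ≡⟨ alg-j ⟩
      μ s         ≡⟨ cong μ alg-k₀ ⟨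
      μ (alg k₀)  ∎)))
      where open ≡-Reasoning
    injective′ : ∀ {k l} → T ((R ∖ k₀) k) → T ((R ∖ k₀) l) → partner k ≡ partner l → k ≡ l
    injective′ dk dl eq with view dk | view dl
    ... | inj₁ (k<i , _) | inj₁ (l<i , _) = alg-injective (μ-injective k<i l<i
                                              (trans (sym (partner-old k<i)) (trans eq (partner-old l<i))))
    ... | inj₁ (k<i , k≢k₀) | inj₂ (refl , k₀≢j) = ⊥-elim (old≢new k<i k≢k₀ k₀≢j eq)
    ... | inj₂ (refl , k₀≢j) | inj₁ (l<i , l≢k₀) = ⊥-elim (old≢new l<i l≢k₀ k₀≢j (sym eq))
    ... | inj₂ (refl , _) | inj₂ (refl , _) = refl

  τ : Fin n → Fin n
  τ k = if ⌊ k ≟ k₀ ⌋ then s else ν⁻¹ (partner k)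

  τ-k₀ : τ k₀ ≡ s
  τ-k₀ with k₀ ≟ k₀
  ... | yes _     = refl
  ... | no k₀≢k₀  = ⊥-elim (k₀≢k₀ refl)

  τ-other : ∀ {k} → k ≢ k₀ → τ k ≡ ν⁻¹ (partner k)
  τ-other {k} k≢k₀ with k ≟ k₀
  ... | yes k≡k₀ = ⊥-elim (k≢k₀ k≡k₀)
  ... | no _     = refl

  ν⁻¹∘partner-maps : MapsInjectively (R ∖ k₀) (T ∘ (lookup P′ ∖ s)) (ν⁻¹ ∘ partner)
  ν⁻¹∘partner-maps = mapsInjectively-∘ partner-maps (record
    { into = ν⁻¹-into
    ; injective = λ dp dp′ eq → trans (sym (ν∘ν⁻¹ dp)) (trans (cong ν eq) (ν∘ν⁻¹ dp′)) })

  τ-maps : MapsInjectively R (T ∘ lookup P′) τ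
  τ-maps = record { into = into′ ; injective = injective′ }
    where
    into′ : ∀ {k} → T (R k) → T (lookup P′ (τ k))
    into′ {k} d with k ≟ k₀
    ... | yes _    = ∈⇒T s∈P′
    ... | no k≢k₀  = proj₁ (T-∖⁻ {D = lookup P′} (ν⁻¹∘partner-maps .into (T-∖⁺ {D = R} d k≢k₀)))
    ≢s : ∀ {k} → T (R k) → k ≢ k₀ → ν⁻¹ (partner k) ≢ s
    ≢s d k≢k₀ = proj₂ (T-∖⁻ {D = lookup P′} (ν⁻¹∘partner-maps .into (T-∖⁺ {D = R} d k≢k₀)))
    injective′ : ∀ {k l} → T (R k) → T (R l) → τ k ≡ τ l → k ≡ l
    injective′ {k} {l} dk dl eq with k ≟ k₀ | l ≟ k₀
    ... | yes k≡k₀ | yes l≡k₀ = trans k≡k₀ (sym l≡k₀)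
    ... | yes _    | no l≢k₀  = ⊥-elim (≢s dl l≢k₀ (sym eq))
    ... | no k≢k₀  | yes _    = ⊥-elim (≢s dk k≢k₀ eq)
    ... | no k≢k₀  | no l≢k₀  = ν⁻¹∘partner-maps .injective (T-∖⁺ {D = R} dk k≢k₀) (T-∖⁺ {D = R} dl l≢k₀) eq

  module Unc = Uncrossing _≟_ x x id (λ _ → refl) id R alg (λ _ _ → alg-injective)
                          (lookup P′) (T ∘ lookup P′) id

  reach : Fin n → ℚ
  reach k = dist x (alg k) (partner k)

  ν-step : Fin n → ℚ
  ν-step k = dist x (ν⁻¹ (partner k)) (ν (ν⁻¹ (partner k)))

  gap-bound : ∀ {k} → T ((R ∖ k₀) k) → Unc.gap τ k ≤ℚ reach k + ν-step k
  gap-bound {k} d = begin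
    abs (x (alg k) - x (τ k))                 ≡⟨ cong (λ q → abs (x (alg k) - x q)) (τ-other k≢k₀) ⟩
    abs (x (alg k) - x (ν⁻¹ p))               ≤⟨ abs-sub-triangle (x (alg k)) (x p) (x (ν⁻¹ p)) ⟩
    reach k + abs (x p - x (ν⁻¹ p))           ≡⟨ cong (reach k +_) (abs-sub-comm (x p) (x (ν⁻¹ p))) ⟩
    reach k + abs (x (ν⁻¹ p) - x p)           ≡⟨ cong (λ q → reach k + abs (x (ν⁻¹ p) - x q)) (ν∘ν⁻¹ p∈P) ⟨
    reach k + ν-step k                        ∎
    where
    open QP.≤-Reasoning
    p : Fin n
    p = partner k
    k≢k₀ : k ≢ k₀
    k≢k₀ = proj₂ (T-∖⁻ {D = R} {k₀} {k} d)
    p∈P : T (lookup P p)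
    p∈P = partner-maps .into d

  old-cost-split : prefixMatchCost x alg i μ ≡ abs (x s - x a) + sumOn (R ∖ k₀) reach
  old-cost-split = begin
    sumOn (below i) (λ k → dist x (alg k) (μ (alg k)))
      ≡⟨ sumOn-cong (below i) (λ {k} d → cong (dist x (alg k)) (partner-old (T-below⁻ {k = k} d))) ⟨
    sumOn (below i) reach                               ≡⟨ QP.+-identityˡ _ ⟨
    0ℚ + sumOn (below i) reach                          ≡⟨ cong (_+ sumOn (below i) reach) reach-j ⟨
    reach j + sumOn (below i) reach                     ≡⟨ sumOn-below-suc j reach ⟨
    sumOn R reach                                       ≡⟨ sumOn-split reach k₀∈R ⟩
    reach k₀ + sumOn (R ∖ k₀) reach
      ≡⟨ cong (_+ sumOn (R ∖ k₀) reach) (cong₂ (λ q q′ → abs (x q - x q′)) alg-k₀ partner-k₀) ⟩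
    abs (x s - x a) + sumOn (R ∖ k₀) reach              ∎
    where
    open ≡-Reasoning
    reach-j : reach j ≡ 0ℚ
    reach-j = trans (cong (dist x a) partner-new) (abs-sub-self (x a))

  cost-bound : Unc.cost τ + abs (x s - x a) ≤ℚ prefixMatchCost x alg i μ + ν-cost
  cost-bound = begin
    Unc.cost τ + d                                                ≡⟨ cong (_+ d) cost-split ⟩
    sumOn (R ∖ k₀) (Unc.gap τ) + d                                ≤⟨ QP.+-monoˡ-≤ d (sumOn-mono (R ∖ k₀) gap-bound) ⟩
    sumOn (R ∖ k₀) (λ k → reach k + ν-step k) + d                 ≡⟨ cong (_+ d) (sumOn-distrib-+ (R ∖ k₀) reach ν-step) ⟩
    (sumOn (R ∖ k₀) reach + sumOn (R ∖ k₀) ν-step) + d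
      ≡⟨ rearrange (sumOn (R ∖ k₀) reach) (sumOn (R ∖ k₀) ν-step) d ⟩
    (d + sumOn (R ∖ k₀) reach) + sumOn (R ∖ k₀) ν-step            ≡⟨ cong (_+ sumOn (R ∖ k₀) ν-step) old-cost-split ⟨
    prefixMatchCost x alg i μ + sumOn (R ∖ k₀) ν-step
      ≤⟨ QP.+-monoʳ-≤ (prefixMatchCost x alg i μ)
                      (sumOn-reindex-≤ (λ q → dist x q (ν q)) ν⁻¹∘partner-maps (λ _ → QP.0≤∣p∣ _)) ⟩
    prefixMatchCost x alg i μ + ν-cost                            ∎
    where
    open QP.≤-Reasoning
    d : ℚ
    d = abs (x s - x a)
    cost-split : Unc.cost τ ≡ sumOn (R ∖ k₀) (Unc.gap τ)
    cost-split = trans (sumOn-split (Unc.gap τ) k₀∈R)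
                       (trans (cong (_+ sumOn (R ∖ k₀) (Unc.gap τ)) (trans (cong (λ q → abs (x q - x (τ k₀))) alg-k₀)
                                                  (trans (cong (λ q → abs (x s - x q)) τ-k₀) (abs-sub-self (x s)))))
                              (QP.+-identityˡ (sumOn (R ∖ k₀) (Unc.gap τ))))
    rearrange : ∀ u v w → (u + v) + w ≡ (w + u) + v
    rearrange = solve 3 (λ u v w → (u ⊕ v) ⊕ w ⊜ (w ⊕ u) ⊕ v) refl

  potential-drop : Σ[ μ′ ∈ (Fin n → Fin n) ] IsFixingMatching alg (suc i) P′ μ′ ×
                     prefixMatchCost x alg (suc i) μ′ + abs (x s - x a) ≤ℚ prefixMatchCost x alg i μ + ν-cost
  potential-drop with Unc.uncross τ-maps
  ... | τ* , τ*-maps , τ*-fixes , τ*-cost with requestAssignment⇒fixingMatching {x = x} alg-injective τ*-maps τ*-fixes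
  ...   | μ′ , μ′-fixing , μ′-cost = μ′ , μ′-fixing , (begin
    prefixMatchCost x alg (suc i) μ′ + abs (x s - x a)   ≡⟨ cong (_+ abs (x s - x a)) μ′-cost ⟩
    Unc.cost τ* + abs (x s - x a)                        ≤⟨ QP.+-monoˡ-≤ (abs (x s - x a)) τ*-cost ⟩
    Unc.cost τ + abs (x s - x a)                         ≤⟨ cost-bound ⟩
    prefixMatchCost x alg i μ + ν-cost                   ∎)
    where open QP.≤-Reasoning

-- nothing stands for the request point ρ.
maybeAssignment⇒rMatching : ∀ {x : Fin n → ℚ} {ρ} {P P′ : Subset n} {τ : Fin n → Maybe (Fin n)} →
  ∣ P′ ∣ ≡ suc ∣ P ∣ → MapsInjectively (lookup P′) (maybe′ (T ∘ lookup P) ⊤) τ →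
  (∀ q → T (lookup P′ q) → T (lookup P q) → τ q ≡ just q) →
  Σ[ s ∈ Fin n ] Σ[ ν ∈ (Fin n → Fin n) ] IsRMatching P′ P s ν ×
    rMatchCost x ρ P′ s ν ≡ sumOn (lookup P′) (λ q → abs (x q - maybe′ x ρ (τ q)))
maybeAssignment⇒rMatching {n} {x} {ρ} {P} {P′} {τ} ∣P′∣≡ τ-maps τ-fixes =
  s , ν , (T⇒∈ s∈P′ , s∉P , ν-into , ν-injective , ν-fixes) , cost-eq
  where
  ν : Fin n → Fin n
  ν q = fromMaybe q (τ q)
  τ≡just : ∀ {q} → τ q ≢ nothing → τ q ≡ just (ν q)
  τ≡just {q} τq≢nothing with τ q
  ... | just p  = refl
  ... | nothing = ⊥-elim (τq≢nothing refl)
  unmatched : ∃[ s ] T (lookup P′ s) × τ s ≡ nothing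
  unmatched with FinP.any? (λ q → T? (lookup P′ q) ×-dec (MaybeP.≡-dec _≟_ (τ q) nothing))
  ... | yes found = found
  ... | no none = ⊥-elim (ℕP.<-irrefl refl (ℕP.≤-trans (ℕP.≤-reflexive (begin
          suc (count (lookup P))  ≡⟨ cong suc (∣p∣≡count P) ⟨
          suc ∣ P ∣               ≡⟨ ∣P′∣≡ ⟨
          ∣ P′ ∣                  ≡⟨ ∣p∣≡count P′ ⟩
          count (lookup P′)       ∎)) (mapsInjectively⇒count≤ ν-maps)))
    where
    open ≡-Reasoning
    τ≢nothing : ∀ {q} → T (lookup P′ q) → τ q ≢ nothing
    τ≢nothing d eq = none (_ , d , eq)
    ν-maps : MapsInjectively (lookup P′) (T ∘ lookup P) ν
    ν-maps = record
      { into = λ d → subst (maybe′ (T ∘ lookup P) ⊤) (τ≡just (τ≢nothing d)) (τ-maps .into d)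
      ; injective = λ d d′ eq → τ-maps .injective d d′
          (trans (τ≡just (τ≢nothing d)) (trans (cong just eq) (sym (τ≡just (τ≢nothing d′))))) }
  s : Fin n
  s = proj₁ unmatched
  s∈P′ : T (lookup P′ s)
  s∈P′ = proj₁ (proj₂ unmatched)
  τs≡nothing : τ s ≡ nothing
  τs≡nothing = proj₂ (proj₂ unmatched)
  s∉P : s ∉ P
  s∉P s∈P with () ← trans (sym τs≡nothing) (τ-fixes s s∈P′ (∈⇒T s∈P))
  τ≡just′ : ∀ {q} → T (lookup P′ q) → q ≢ s → τ q ≡ just (ν q)
  τ≡just′ d q≢s = τ≡just (λ τq≡nothing → q≢s (τ-maps .injective d s∈P′ (trans τq≡nothing (sym τs≡nothing))))
  ν-into : ∀ q → q ∈ P′ → q ≢ s → ν q ∈ P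
  ν-into q q∈P′ q≢s = T⇒∈ (subst (maybe′ (T ∘ lookup P) ⊤) (τ≡just′ (∈⇒T q∈P′) q≢s) (τ-maps .into (∈⇒T q∈P′)))
  ν-injective : ∀ q q′ → q ∈ P′ → q′ ∈ P′ → q ≢ s → q′ ≢ s → ν q ≡ ν q′ → q ≡ q′
  ν-injective q q′ q∈P′ q′∈P′ q≢s q′≢s eq = τ-maps .injective (∈⇒T q∈P′) (∈⇒T q′∈P′)
    (trans (τ≡just′ (∈⇒T q∈P′) q≢s) (trans (cong just eq) (sym (τ≡just′ (∈⇒T q′∈P′) q′≢s))))
  ν-fixes : ∀ q → q ∈ P′ → q ∈ P → ν q ≡ q
  ν-fixes q q∈P′ q∈P = cong (fromMaybe q) (τ-fixes q (∈⇒T q∈P′) (∈⇒T q∈P))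
  cost-eq : rMatchCost x ρ P′ s ν ≡ sumOn (lookup P′) (λ q → abs (x q - maybe′ x ρ (τ q)))
  cost-eq = sym (trans (sumOn-split (λ q → abs (x q - maybe′ x ρ (τ q))) s∈P′)
                       (cong₂ _+_ (trans (cong (λ u → abs (x s - maybe′ x ρ u)) τs≡nothing) (abs-sub-comm (x s) ρ))
                                  (sumOn-cong (lookup P′ ∖ s) λ {q} d →
                                    let q∈P′ , q≢s = T-∖⁻ {D = lookup P′} {s} {q} d in
                                    cong (λ u → abs (x q - maybe′ x ρ u)) (τ≡just′ q∈P′ q≢s))))

prefixMatching⇒mapsInjectively : ∀ {f : Fin n → Fin n} {i} {Y : Subset n} {m} → Injective _≡_ _≡_ f →
  IsPrefixMatching f i Y m → MapsInjectively (below i) (T ∘ lookup Y) (m ∘ f)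
prefixMatching⇒mapsInjectively f-injective (into , injective) = record
  { into      = λ {k} d → ∈⇒T (into k (T-below⁻ {k = k} d))
  ; injective = λ {k} {l} dk dl eq → f-injective (injective k l (T-below⁻ {k = k} dk) (T-below⁻ {k = l} dl) eq) }

module ViaOffline {x : Fin n → ℚ} {off : Fin n → Fin n} (off-injective : Injective _≡_ _≡_ off)
  (j : Fin n) {P P′ : Subset n} (∣P∣≡ : ∣ P ∣ ≡ toℕ j) (∣P′∣≡ : ∣ P′ ∣ ≡ suc (toℕ j))
  {m₁ m₂ : Fin n → Fin n} (pm₁ : IsPrefixMatching off (toℕ j) P m₁) (pm₂ : IsPrefixMatching off (suc (toℕ j)) P′ m₂)
  (ρ : ℚ) where

  i : ℕ
  i = toℕ j

  R : Fin n → Bool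
  R = below (suc i)

  m₂∘off-maps : MapsInjectively R (T ∘ lookup P′) (m₂ ∘ off)
  m₂∘off-maps = prefixMatching⇒mapsInjectively {m = m₂} off-injective pm₂

  pre-inverse : Σ[ pre ∈ (Fin n → Fin n) ] (∀ {q} → T (lookup P′ q) → T (R (pre q)) × m₂ (off (pre q)) ≡ q)
  pre-inverse = mapsInjectively⇒inverse m₂∘off-maps (ℕP.≤-reflexive (begin
    count (lookup P′)  ≡⟨ ∣p∣≡count P′ ⟨
    ∣ P′ ∣             ≡⟨ ∣P′∣≡ ⟩
    suc i              ≡⟨ count-below (FinP.toℕ<n j) ⟨
    count R            ∎))
    where open ≡-Reasoning

  pre : Fin n → Fin n
  pre = proj₁ pre-inverse

  m₂∘off∘pre : ∀ {q} → T (lookup P′ q) → m₂ (off (pre q)) ≡ q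
  m₂∘off∘pre = proj₂ ∘ proj₂ pre-inverse

  pre-maps : MapsInjectively (lookup P′) (T ∘ R) pre
  pre-maps = record
    { into      = proj₁ ∘ proj₂ pre-inverse
    ; injective = λ d d′ eq → trans (sym (m₂∘off∘pre d)) (trans (cong (m₂ ∘ off) eq) (m₂∘off∘pre d′)) }

  V : Maybe (Fin n) → Set
  V = maybe′ (T ∘ lookup P) ⊤

  pos : Maybe (Fin n) → ℚ
  pos = maybe′ x ρ

  viaOff : Fin n → Maybe (Fin n)
  viaOff k = if ⌊ k ≟ j ⌋ then nothing else just (m₁ (off k))

  viaOff-old : ∀ {k} → k ≢ j → viaOff k ≡ just (m₁ (off k))
  viaOff-old {k} k≢j with k ≟ j
  ... | yes k≡j = ⊥-elim (k≢j k≡j)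
  ... | no _    = refl

  viaOff-new : viaOff j ≡ nothing
  viaOff-new with j ≟ j
  ... | yes _   = refl
  ... | no j≢j  = ⊥-elim (j≢j refl)

  viaOff-maps : MapsInjectively R V viaOff
  viaOff-maps = record { into = λ {k} → into′ {k} ; injective = injective′ }
    where
    m₁∘off-maps : MapsInjectively (below i) (T ∘ lookup P) (m₁ ∘ off)
    m₁∘off-maps = prefixMatching⇒mapsInjectively {m = m₁} off-injective pm₁
    old : ∀ {k} → T (R k) → k ≢ j → T (below i k)
    old {k} d k≢j = subst T (below-suc∖last j k) (T-∖⁺ {D = R} d k≢j)
    into′ : ∀ {k} → T (R k) → V (viaOff k)
    into′ {k} d with k ≟ j
    ... | yes _   = tt
    ... | no k≢j  = m₁∘off-maps .into (old d k≢j)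
    injective′ : ∀ {k l} → T (R k) → T (R l) → viaOff k ≡ viaOff l → k ≡ l
    injective′ {k} {l} dk dl eq with k ≟ j | l ≟ j
    ... | yes k≡j | yes l≡j = trans k≡j (sym l≡j)
    ... | no k≢j  | no l≢j  = m₁∘off-maps .injective (old dk k≢j) (old dl l≢j) (MaybeP.just-injective eq)

  module Unc = Uncrossing (MaybeP.≡-dec _≟_) pos x just (λ _ → refl) MaybeP.just-injective
                          (lookup P′) id (λ _ _ → id) (lookup P) V id

  τ₀-maps : MapsInjectively (lookup P′) V (viaOff ∘ pre)
  τ₀-maps = mapsInjectively-∘ pre-maps viaOff-maps

  toOff : Fin n → ℚ
  toOff k = abs (x (m₂ (off k)) - x (off k))

  fromOff : Fin n → ℚ
  fromOff k = abs (x (off k) - pos (viaOff k))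

  sumOn-toOff : sumOn R toOff ≡ prefixMatchCost x off (suc i) m₂
  sumOn-toOff = sumOn-cong R (λ {k} _ → abs-sub-comm (x (m₂ (off k))) (x (off k)))

  sumOn-fromOff : sumOn R fromOff ≡ abs (x (off j) - ρ) + prefixMatchCost x off i m₁
  sumOn-fromOff = trans (sumOn-below-suc j fromOff)
    (cong₂ _+_ (cong (λ u → abs (x (off j) - pos u)) viaOff-new)
               (sumOn-cong (below i) λ {k} d → cong (λ u → abs (x (off k) - pos u))
                                                    (viaOff-old (λ k≡j → ℕP.<-irrefl (cong toℕ k≡j) (T-below⁻ {k = k} d)))))

  cost₀-bound : Unc.cost (viaOff ∘ pre) ≤ℚ prefixMatchCost x off i m₁ + (abs (ρ - x (off j)) + prefixMatchCost x off (suc i) m₂)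
  cost₀-bound = begin
    Unc.cost (viaOff ∘ pre)                                  ≤⟨ sumOn-mono (lookup P′) through-off ⟩
    sumOn (lookup P′) (λ q → toOff (pre q) + fromOff (pre q)) ≡⟨ sumOn-distrib-+ (lookup P′) (toOff ∘ pre) (fromOff ∘ pre) ⟩
    sumOn (lookup P′) (toOff ∘ pre) + sumOn (lookup P′) (fromOff ∘ pre)
      ≤⟨ QP.+-mono-≤ (sumOn-reindex-≤ toOff pre-maps (λ _ → QP.0≤∣p∣ _))
                     (sumOn-reindex-≤ fromOff pre-maps (λ _ → QP.0≤∣p∣ _)) ⟩
    sumOn R toOff + sumOn R fromOff                          ≡⟨ cong₂ _+_ sumOn-toOff sumOn-fromOff ⟩
    A₂ + (abs (x (off j) - ρ) + A₁)                          ≡⟨ cong (λ d → A₂ + (d + A₁)) (abs-sub-comm (x (off j)) ρ) ⟩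
    A₂ + (abs (ρ - x (off j)) + A₁)                          ≡⟨ reverse A₂ (abs (ρ - x (off j))) A₁ ⟩
    A₁ + (abs (ρ - x (off j)) + A₂)                          ∎
    where
    open QP.≤-Reasoning
    A₁ A₂ : ℚ
    A₁ = prefixMatchCost x off i m₁
    A₂ = prefixMatchCost x off (suc i) m₂
    through-off : ∀ {q} → T (lookup P′ q) → Unc.gap (viaOff ∘ pre) q ≤ℚ toOff (pre q) + fromOff (pre q)
    through-off {q} d = subst (λ p → abs (x p - pos (viaOff (pre q))) ≤ℚ toOff (pre q) + fromOff (pre q))
                              (m₂∘off∘pre d) (abs-sub-triangle (x (m₂ (off (pre q)))) (x (off (pre q))) (pos (viaOff (pre q))))
    reverse : ∀ u v w → u + (v + w) ≡ w + (v + u)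
    reverse = solve 3 (λ u v w → u ⊕ (v ⊕ w) ⊜ w ⊕ (v ⊕ u)) refl

  optRMatching-bound : ∀ {s ν} → IsOptRMatching x ρ P′ P s ν →
    rMatchCost x ρ P′ s ν ≤ℚ prefixMatchCost x off i m₁ + (abs (ρ - x (off j)) + prefixMatchCost x off (suc i) m₂)
  optRMatching-bound {s} {ν} (_ , optimal) with Unc.uncross τ₀-maps
  ... | τ , τ-maps , τ-fixes , τ-cost
    with maybeAssignment⇒rMatching {x = x} {ρ} (trans ∣P′∣≡ (cong suc (sym ∣P∣≡))) τ-maps τ-fixes
  ...   | s′ , ν′ , isR′ , cost′ = begin
    rMatchCost x ρ P′ s ν      ≤⟨ optimal s′ ν′ isR′ ⟩
    rMatchCost x ρ P′ s′ ν′    ≡⟨ cost′ ⟩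
    Unc.cost τ                 ≤⟨ τ-cost ⟩
    Unc.cost (viaOff ∘ pre)    ≤⟨ cost₀-bound ⟩
    _                          ∎
    where open QP.≤-Reasoning

module FollowThePrediction {x : Fin n → ℚ} {r : Fin n → ℚ} {P : ℕ → Subset n} (∣P∣≡ : ∀ i → i ≤ n → ∣ P i ∣ ≡ i)
                           {alg : Fin n → Fin n} (run : IsFtPRun x r P alg) where

  module Round (j : Fin n) where

    i : ℕ
    i = toℕ j

    μ : Fin n → Fin n
    μ = proj₁ (run j)

    s : Fin n
    s = proj₁ (proj₂ (run j))

    ν : Fin n → Fin n
    ν = proj₁ (proj₂ (proj₂ (run j)))

    isMu : IsMu x alg i (P i) μ
    isMu = proj₁ (proj₂ (proj₂ (proj₂ (run j))))

    isOpt : IsOptRMatching x (r j) (P (suc i)) (P i) s ν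
    isOpt = proj₁ (proj₂ (proj₂ (proj₂ (proj₂ (run j)))))

    alg-j : alg j ≡ μ s
    alg-j = proj₂ (proj₂ (proj₂ (proj₂ (proj₂ (run j)))))

    ∣Pᵢ∣≡ : ∣ P i ∣ ≡ i
    ∣Pᵢ∣≡ = ∣P∣≡ i (ℕP.<⇒≤ (FinP.toℕ<n j))

    ∣Pᵢ₊₁∣≡ : ∣ P (suc i) ∣ ≡ suc i
    ∣Pᵢ₊₁∣≡ = ∣P∣≡ (suc i) (FinP.toℕ<n j)

    optCost : ℚ
    optCost = rMatchCost x (r j) (P (suc i)) s ν

    open MinimalFixingMatching {x = x} isMu public using (μ-minimal)
    open MinimalFixingMatching {x = x} isMu using (μ-fresh)

    fresh : ¬ InPrefix alg i (alg j)
    fresh = subst (¬_ ∘ InPrefix alg i) (sym alg-j) (μ-fresh (proj₁ (proj₂ (proj₁ isOpt))))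

  open Round using (optCost)

  alg-injective : Injective _≡_ _≡_ alg
  alg-injective {j} {k} alg-j≡alg-k with ℕP.<-cmp (toℕ j) (toℕ k)
  ... | tri< j<k _ _ = ⊥-elim (Round.fresh k (j , j<k , alg-j≡alg-k))
  ... | tri≈ _ j≡k _ = FinP.toℕ-injective j≡k
  ... | tri> _ _ k<j = ⊥-elim (Round.fresh j (k , k<j , sym alg-j≡alg-k))

  -- No μ is given after the last round; Φ n is set to 0.
  Φ : ℕ → ℚ
  Φ i with i ℕ.<? n
  ... | yes i<n = prefixMatchCost x alg i (Round.μ (fromℕ< i<n))
  ... | no  _   = 0ℚ

  Φ-round : ∀ j → Φ (toℕ j) ≡ prefixMatchCost x alg (toℕ j) (Round.μ j)
  Φ-round j with toℕ j ℕ.<? n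
  ... | yes j<n = cong (prefixMatchCost x alg (toℕ j) ∘ Round.μ) (FinP.fromℕ<-toℕ j j<n)
  ... | no  j≮n = ⊥-elim (j≮n (FinP.toℕ<n j))

  Φ-minimal : ∀ i μ′ → IsFixingMatching alg i (P i) μ′ → Φ i ≤ℚ prefixMatchCost x alg i μ′
  Φ-minimal i μ′ fixing with i ℕ.<? n
  ... | yes i<n = minimal (fromℕ< i<n) (FinP.toℕ-fromℕ< i<n)
    where
    minimal : ∀ j → toℕ j ≡ i → prefixMatchCost x alg i (Round.μ j) ≤ℚ prefixMatchCost x alg i μ′
    minimal j refl = Round.μ-minimal j μ′ fixing
  ... | no _ = sumOn-nonneg (below i) (λ k → dist x (alg k) (μ′ (alg k))) (λ _ → QP.0≤∣p∣ _)

  Φ-initial : Φ 0 ≡ 0ℚ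
  Φ-initial with 0 ℕ.<? n
  ... | yes 0<n = sumOn-below-zero (λ k → dist x (alg k) (Round.μ (fromℕ< 0<n) (alg k)))
  ... | no  _ = refl

  Φ-final : Φ n ≡ 0ℚ
  Φ-final with n ℕ.<? n
  ... | yes n<n = ⊥-elim (ℕP.<-irrefl refl n<n)
  ... | no  _   = refl

  module _ (j : Fin n) where
    open Round j hiding (optCost)
    open PotentialDrop {x = x} alg-injective j ∣Pᵢ∣≡ ∣Pᵢ₊₁∣≡ isMu (proj₁ isOpt) alg-j using (ν-cost; potential-drop)

    round-≤ : abs (r j - x (alg j)) + Φ (suc i) ≤ℚ optCost j + Φ i
    round-≤ = begin
      abs (r j - x a) + Φ (suc i)
        ≤⟨ QP.+-mono-≤ (abs-sub-triangle (r j) (x s) (x a)) (Φ-minimal (suc i) μ′ μ′-fixing) ⟩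
      (abs (r j - x s) + abs (x s - x a)) + μ′-cost          ≡⟨ shuffle (abs (r j - x s)) (abs (x s - x a)) μ′-cost ⟩
      abs (r j - x s) + (μ′-cost + abs (x s - x a))          ≤⟨ QP.+-monoʳ-≤ (abs (r j - x s)) drop ⟩
      abs (r j - x s) + (prefixMatchCost x alg i μ + ν-cost) ≡⟨ shuffle′ (abs (r j - x s)) (prefixMatchCost x alg i μ) ν-cost ⟩
      optCost j + prefixMatchCost x alg i μ                  ≡⟨ cong (optCost j +_) (Φ-round j) ⟨
      optCost j + Φ i                                        ∎
      where
      open QP.≤-Reasoning
      a : Fin n
      a = alg j
      μ′ : Fin n → Fin n
      μ′ = proj₁ potential-drop
      μ′-fixing : IsFixingMatching alg (suc i) (P (suc i)) μ′
      μ′-fixing = proj₁ (proj₂ potential-drop)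
      μ′-cost : ℚ
      μ′-cost = prefixMatchCost x alg (suc i) μ′
      drop : μ′-cost + abs (x s - x a) ≤ℚ prefixMatchCost x alg i μ + ν-cost
      drop = proj₂ (proj₂ potential-drop)
      shuffle : ∀ u v w → (u + v) + w ≡ u + (w + v)
      shuffle = solve 3 (λ u v w → (u ⊕ v) ⊕ w ⊜ u ⊕ (w ⊕ v)) refl
      shuffle′ : ∀ u v w → u + (v + w) ≡ (u + w) + v
      shuffle′ = solve 3 (λ u v w → u ⊕ (v ⊕ w) ⊜ (u ⊕ w) ⊕ v) refl

  cost-≤-optCosts : matchCost x r alg ≤ℚ sumFin optCost
  cost-≤-optCosts = subst₂ _≤ℚ_ (cancel Φ-final) (cancel Φ-initial)
                           (telescope (λ j → abs (r j - x (alg j))) optCost Φ round-≤)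
    where
    cancel : ∀ {u v} → v ≡ 0ℚ → u + v ≡ u
    cancel {u} refl = QP.+-identityʳ u

-- η i is only given for 1 ≤ i; before the first request both configurations are empty.
errorAt : (ℕ → ℚ) → ℕ → ℚ
errorAt η zero    = 0ℚ
errorAt η (suc i) = η (suc i)

dist-nonneg : ∀ {x : Fin n → ℚ} {f i Y d} → IsDist x f i Y d → 0ℚ ≤ℚ d
dist-nonneg {x = x} {f} {i} ((m , _ , cost≡d) , _) =
  subst (0ℚ ≤ℚ_) cost≡d (sumOn-nonneg (below i) (λ k → dist x (f k) (m (f k))) (λ _ → QP.0≤∣p∣ _))

offlineMatching : ∀ {x : Fin n → ℚ} {off} {P : ℕ → Subset n} {η} →
  (∀ i → 1 ≤ i → i ≤ n → IsDist x off i (P i) (η i)) →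
  ∀ i → i ≤ n → Σ[ m ∈ (Fin n → Fin n) ] IsPrefixMatching off i (P i) m × prefixMatchCost x off i m ≡ errorAt η i
offlineMatching {x = x} {off} η-dist zero _ = id , ((λ _ ()) , (λ _ _ ())) , sumOn-below-zero (λ k → dist x (off k) (off k))
offlineMatching η-dist (suc i) i<n = proj₁ (η-dist (suc i) (s≤s z≤n) i<n)

optRMatchCost-≤ : ∀ {x : Fin n → ℚ} {off} {P : ℕ → Subset n} {η} → Injective _≡_ _≡_ off →
  (∀ i → i ≤ n → ∣ P i ∣ ≡ i) → (∀ i → 1 ≤ i → i ≤ n → IsDist x off i (P i) (η i)) →
  ∀ j {ρ s ν} → IsOptRMatching x ρ (P (suc (toℕ j))) (P (toℕ j)) s ν →
  rMatchCost x ρ (P (suc (toℕ j))) s ν ≤ℚ errorAt η (toℕ j) + (abs (ρ - x (off j)) + η (suc (toℕ j)))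
optRMatchCost-≤ {x = x} {off} {P} {η} off-injective ∣P∣≡ η-dist j {ρ} isOpt
  with offlineMatching {x = x} {off} {P} {η} η-dist (toℕ j) (ℕP.<⇒≤ (FinP.toℕ<n j))
     | proj₁ (η-dist (suc (toℕ j)) (s≤s z≤n) (FinP.toℕ<n j))
... | m₁ , pm₁ , cost₁ | m₂ , pm₂ , cost₂ =
  subst (rMatchCost x ρ (P (suc (toℕ j))) _ _ ≤ℚ_) (cong₂ (λ u v → u + (abs (ρ - x (off j)) + v)) cost₁ cost₂)
        (ViaOffline.optRMatching-bound {x = x} off-injective j (∣P∣≡ (toℕ j) (ℕP.<⇒≤ (FinP.toℕ<n j)))
                                       (∣P∣≡ (suc (toℕ j)) (FinP.toℕ<n j)) {m₁} {m₂} pm₁ pm₂ ρ isOpt)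

sumFin-errorAt-≤ : ∀ {x : Fin n → ℚ} {off} {P : ℕ → Subset n} {η} →
  (∀ i → 1 ≤ i → i ≤ n → IsDist x off i (P i) (η i)) →
  sumFin {n} (errorAt η ∘ toℕ) ≤ℚ sum1to n η
sumFin-errorAt-≤ {zero}  η-dist = QP.≤-refl
sumFin-errorAt-≤ {suc m} {x = x} {η = η} η-dist = subst (_≤ℚ sum1to (suc m) η) (sym (sumFin-errorAt m))
  (p≤p+q (sum1to m η) (dist-nonneg {x = x} (η-dist (suc m) (s≤s z≤n) ℕP.≤-refl)))
  where
  sumFin-errorAt : ∀ m → sumFin {suc m} (errorAt η ∘ toℕ) ≡ sum1to m η
  sumFin-errorAt zero    = QP.+-identityʳ 0ℚ
  sumFin-errorAt (suc m) = trans (sumFin-toℕ-snoc (errorAt η) (suc m)) (cong (_+ η (suc m)) (sumFin-errorAt m))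

theorem10 : (n : ℕ) (x : Fin n → ℚ) → Injective _≡_ _≡_ x →
    (r : Fin n → ℚ) (P : ℕ → Subset n) → (∀ i → i ≤ n → ∣ P i ∣ ≡ i) →
    (off : Fin n → Fin n) → Injective _≡_ _≡_ off →
    (η : ℕ → ℚ) → (∀ i → 1 ≤ i → i ≤ n → IsDist x off i (P i) (η i)) →
    (alg : Fin n → Fin n) → IsFtPRun x r P alg →
    matchCost x r alg ≤ℚ matchCost x r off + (sum1to n η + sum1to n η)
theorem10 n x _ r P ∣P∣≡ off off-injective η η-dist alg run = begin
  matchCost x r alg                                    ≤⟨ FtP.cost-≤-optCosts ⟩
  sumFin FtP.Round.optCost                             ≤⟨ sumFin-mono optCost-≤ ⟩
  sumFin (λ j → error j + (abs (r j - x (off j)) + error′ j))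
    ≡⟨ trans (sumFin-distrib-+ error (λ j → abs (r j - x (off j)) + error′ j))
             (cong (sumFin error +_) (sumFin-distrib-+ (λ j → abs (r j - x (off j))) error′)) ⟩
  sumFin error + (matchCost x r off + sumFin error′)
    ≤⟨ QP.+-mono-≤ (sumFin-errorAt-≤ {x = x} {η = η} η-dist)
                   (QP.≤-reflexive (cong (matchCost x r off +_) (sumFin≡sum1to η n))) ⟩
  sum1to n η + (matchCost x r off + sum1to n η)        ≡⟨ swap (sum1to n η) (matchCost x r off) (sum1to n η) ⟩
  matchCost x r off + (sum1to n η + sum1to n η)        ∎
  where
  open QP.≤-Reasoning
  module FtP = FollowThePrediction {x = x} {r} {P} ∣P∣≡ run
  error error′ : Fin n → ℚ
  error  j = errorAt η (toℕ j)
  error′ j = η (suc (toℕ j))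
  optCost-≤ : ∀ j → FtP.Round.optCost j ≤ℚ error j + (abs (r j - x (off j)) + error′ j)
  optCost-≤ j = optRMatchCost-≤ {x = x} {η = η} off-injective ∣P∣≡ η-dist j {r j} (FtP.Round.isOpt j)
  swap : ∀ u v w → u + (v + w) ≡ v + (u + w)
  swap = solve 3 (λ u v w → u ⊕ (v ⊕ w) ⊜ v ⊕ (u ⊕ w)) refl
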